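{- For all integers $n \ge k \ge 3$, $$S(n,k)= (k-1)2^n+1+\sum_{s=n-k+2}^{n}\binom{n}{s}.$$
   Context: Write $[n]=\{1,\ldots,n\}$ and $2^{[n]}$ for the family of all subsets of $[n]$. Given families ${\cal A}_1,\ldots,{\cal A}_k\subset 2^{[n]}$, a multicolor sunflower with $k$ petals is a choice of sets $A_i\in{\cal A}_i$, $i=1,\ldots,k$, together with a set $C$ such that $A_i\cap A_j=C$ for all $i\neq j$ and $A_i\setminus C\neq\emptyset$ for all $i\in[k]$. The tuple ${\cal A}_1,\ldots,{\cal A}_k$ is called sunflower-free if it contains no multicolor sunflower with $k$ petals. Let ${\cal F}(n,k)$ be the set of all $k$-tuples $({\cal A}_1,\ldots,{\cal A}_k)$ of families ${\cal A}_i\subset 2^{[n]}$ that are sunflower-free, and define $S(n,k)=\max_{({\cal A}_i)\in{\cal F}(n,k)}\sum_{i=1}^k|{\cal A}_i|$. -}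

module Defs where

open import Data.Bool using (Bool; true; false)
open import Data.Nat using (ℕ; zero; suc; _+_; _∸_; _*_; _^_)
open import Data.Nat.ListAction using (sum)
open import Data.Nat.Combinatorics using (_C_)
open import Data.Fin using (Fin)
open import Data.Fin.Subset using (Subset; _∩_; _─_; Nonempty)
open import Data.Vec using ([]; _∷_)
open import Data.List using (List; []; _∷_; map; _++_; allFin; applyUpTo; length; filterᵇ)
open import Data.Product using (Σ; _×_)
open import Relation.Binary.PropositionalEquality using (_≡_)
open import Relation.Nullary using (¬_)

allSubsets : (n : ℕ) → List (Subset n)
allSubsets zero = [] ∷ []
allSubsets (suc n) = map (true ∷_) (allSubsets n) ++ map (false ∷_) (allSubsets n)

-- A family 𝒜 ⊆ 2^[n], given by its (decidable) membership function.
Family : ℕ → Set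
Family n = Subset n → Bool

card : {n : ℕ} → Family n → ℕ
card {n} 𝒜 = length (filterᵇ 𝒜 (allSubsets n))

MulticolorSunflower : {n k : ℕ} → (Fin k → Family n) → Set
MulticolorSunflower {n} {k} 𝒜 =
  Σ (Fin k → Subset n) λ A → Σ (Subset n) λ C →
    ((i : Fin k) → 𝒜 i (A i) ≡ true)
    × ((i j : Fin k) → ¬ (i ≡ j) → (A i ∩ A j) ≡ C)
    × ((i : Fin k) → Nonempty (A i ─ C))

SunflowerFree : {n k : ℕ} → (Fin k → Family n) → Set
SunflowerFree 𝒜 = ¬ MulticolorSunflower 𝒜

totalSize : {n k : ℕ} → (Fin k → Family n) → ℕ
totalSize {n} {k} 𝒜 = sum (map (λ i → card (𝒜 i)) (allFin k))

rangeSum : ℕ → ℕ → (ℕ → ℕ) → ℕ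
rangeSum a len f = sum (applyUpTo (λ i → f (a + i)) len)

-- The claimed value (k-1)2^n + 1 + Σ_{s=n-k+2}^{n} C(n,s)   (for n ≥ k ≥ 3;
-- the range n-k+2..n has k-1 terms).
claimedValue : ℕ → ℕ → ℕ
claimedValue n k = (k ∸ 1) * 2 ^ n + 1 + rangeSum (n + 2 ∸ k) (k ∸ 1) (λ s → n C s)

IsMaxSunflowerFreeSize : ℕ → ℕ → ℕ → Set
IsMaxSunflowerFreeSize n k m =
  ((𝒜 : Fin k → Family n) → SunflowerFree 𝒜 → totalSize 𝒜 Data.Nat.≤ m)
  × Σ (Fin k → Family n) λ 𝒜 → SunflowerFree 𝒜 × (totalSize 𝒜 ≡ m)

-- Let z(B) be the number of families 𝒜ᵢ missing B. If a set X has at least k points outside it but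
-- fewer than that many pairs (a, i) with a ∉ X and X ∪ {a} ∉ 𝒜ᵢ, a greedy matching gives distinct
-- points aᵢ with X ∪ {aᵢ} ∈ 𝒜ᵢ: a sunflower with core X. Hence, for a sunflower-free tuple, double
-- counting the pairs (X, a) with |X| = t − 1 gives Σ_{|B| = t} z(B) ≥ C(n, t) on every level
-- 1 ≤ t ≤ n − k + 1, and Σᵢ |𝒜ᵢ| = k 2ⁿ − Σ_B z(B) ≤ (k − 1) 2ⁿ + 1 + Σ_{t > n − k + 1} C(n, t).
-- Equality holds for k − 1 copies of 2^[n] and {∅} ∪ {B : |B| > n − k + 1}: in a sunflower there,
-- the k − 1 other petals would need k − 1 distinct points outside the large petal.
module Submission where

open import Defs
open import Data.Bool using (Bool; true; false; not; T)
open import Data.Bool.Properties using (∧-identityʳ; ∧-idem; not-injective)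
open import Data.Fin using (Fin; zero; suc; punchIn)
import Data.Fin.Properties as Fin
open import Data.Fin.Subset using (Subset; inside; ∣_∣; _∈_; _∉_; _∩_; _─_; _-_; ∁; Nonempty)
open import Data.Fin.Subset.Properties
  using (∣p∣≤n; ∩-idem; ∩-comm; x∈p⇒∣p-x∣<∣p∣; x∈p∧x≢y⇒x∈p-y; x∈p∩q⁺; p─q⊆p; ∣∁p∣≡n∸∣p∣; x∉p⇒x∈∁p)
open import Data.List using ([]; _∷_; applyUpTo; map; _++_; tabulate; length; filterᵇ)
open import Data.List.Properties using (map-++; map-∘; map-tabulate)
open import Data.Nat
  using (ℕ; zero; suc; _+_; _*_; _^_; _∸_; pred; _≤_; _<_; _≤?_; _<?_; _≡ᵇ_; z≤n; s≤s; s≤s⁻¹; z<s; s<s)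
open import Data.Nat.Combinatorics using (_C_; nCk+nC[k+1]≡[n+1]C[k+1])
import Data.Nat.ListAction as List
open import Data.Nat.ListAction.Properties using (sum-++)
open import Data.Nat.Properties
open import Data.Nat.Tactic.RingSolver using (solve-∀)
open import Data.Product using (∃; _×_; _,_; proj₁; proj₂)
open import Data.Sum using (_⊎_; inj₁; inj₂; map₁)
open import Data.Vec using ([]; _∷_; lookup; _[_]≔_; here; there)
open import Function using (_∘_; id)
open import Function.Definitions using (Injective)
open import Relation.Binary.PropositionalEquality
open import Relation.Nullary using (yes; no; contradiction)
open import Relation.Nullary.Decidable using (does; dec-true; dec-false; decidable-stable)

open import Algebra.Properties.CommutativeSemigroup +-commutativeSemigroup using (interchange)
open import Algebra.Properties.CommutativeSemigroup *-commutativeSemigroup using (x∙yz≈y∙xz)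
open import Algebra.Properties.Semiring.Sum +-*-semiring
  using (sum; sum-syntax; sum-cong-≗; ∑-distrib-+; *-distribˡ-sum; sum-remove; sum-replicate-zero)

𝟙 : Bool → ℕ
𝟙 true  = 1
𝟙 false = 0

𝟙-+-𝟙-not : ∀ b → 𝟙 b + 𝟙 (not b) ≡ 1
𝟙-+-𝟙-not true  = refl
𝟙-+-𝟙-not false = refl

𝟙-pos : ∀ {b} → 0 < 𝟙 b → b ≡ true
𝟙-pos {true} _ = refl

𝟙-not≡0 : ∀ {b} → 𝟙 (not b) ≡ 0 → b ≡ true
𝟙-not≡0 {true} _ = refl

𝟙*-<-𝟙 : ∀ b x → 𝟙 b * x < 𝟙 b → b ≡ true × x ≡ 0
𝟙*-<-𝟙 true x x+0<1 = refl , n<1⇒n≡0 (subst (_< 1) (+-identityʳ x) x+0<1)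

0<𝟙* : ∀ b x → 0 < 𝟙 b * x → b ≡ true × 0 < x
0<𝟙* true x 0<x+0 = refl , subst (0 <_) (+-identityʳ x) 0<x+0

𝟙≡ᵇ-subst : ∀ (g : ℕ → ℕ) s t → 𝟙 (s ≡ᵇ t) * g s ≡ 𝟙 (s ≡ᵇ t) * g t
𝟙≡ᵇ-subst g s t with s ≡ᵇ t in s≡ᵇt
... | false = refl
... | true  = cong (λ r → 1 * g r) (≡ᵇ⇒≡ s t (subst T (sym s≡ᵇt) _))

sum-const : ∀ k c → ∑[ i < k ] c ≡ k * c
sum-const zero    c = refl
sum-const (suc k) c = cong (c +_) (sum-const k c)

term≤sum : ∀ {n} (f : Fin n → ℕ) i → f i ≤ sum f
term≤sum {suc n} f i = ≤-trans (m≤m+n (f i) _) (≤-reflexive (sym (sum-remove {i = i} f)))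

∑<∑⇒∃< : ∀ {k} (f g : Fin k → ℕ) → sum f < sum g → ∃ λ i → f i < g i
∑<∑⇒∃< {suc k} f g f<g with f zero <? g zero
... | yes f₀<g₀ = zero , f₀<g₀
... | no  f₀≮g₀ =
  let i , fᵢ<gᵢ = ∑<∑⇒∃< (f ∘ suc) (g ∘ suc) (+-cancelˡ-< (g zero) _ _ g₀+∑f<g₀+∑g) in suc i , fᵢ<gᵢ
  where
  g₀+∑f<g₀+∑g : g zero + sum (f ∘ suc) < g zero + sum (g ∘ suc)
  g₀+∑f<g₀+∑g = ≤-<-trans (+-monoˡ-≤ _ (≮⇒≥ f₀≮g₀)) f<g

0<∑⇒∃0< : ∀ {n} (f : Fin n → ℕ) → 0 < sum f → ∃ λ i → 0 < f i
0<∑⇒∃0< {n} f 0<∑f = ∑<∑⇒∃< (λ _ → 0) f (subst (_< sum f) (sym (sum-replicate-zero n)) 0<∑f)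

sumSubsets : ∀ n → (Subset n → ℕ) → ℕ
sumSubsets zero    f = f []
sumSubsets (suc n) f = sumSubsets n (f ∘ (true ∷_)) + sumSubsets n (f ∘ (false ∷_))

infixl 10 sumSubsets
syntax sumSubsets n (λ B → e) = ∑[ B ⊆ n ] e

sumSubsets-cong : ∀ n {f g : Subset n → ℕ} → (∀ B → f B ≡ g B) → ∑[ B ⊆ n ] f B ≡ ∑[ B ⊆ n ] g B
sumSubsets-cong zero    f≗g = f≗g []
sumSubsets-cong (suc n) f≗g =
  cong₂ _+_ (sumSubsets-cong n (f≗g ∘ (true ∷_))) (sumSubsets-cong n (f≗g ∘ (false ∷_)))

sumSubsets-mono-≤ : ∀ n {f g : Subset n → ℕ} → (∀ B → f B ≤ g B) → ∑[ B ⊆ n ] f B ≤ ∑[ B ⊆ n ] g B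
sumSubsets-mono-≤ zero    f≤g = f≤g []
sumSubsets-mono-≤ (suc n) f≤g =
  +-mono-≤ (sumSubsets-mono-≤ n (f≤g ∘ (true ∷_))) (sumSubsets-mono-≤ n (f≤g ∘ (false ∷_)))

sumSubsets-distrib-+ : ∀ n (f g : Subset n → ℕ) →
  ∑[ B ⊆ n ] (f B + g B) ≡ ∑[ B ⊆ n ] f B + ∑[ B ⊆ n ] g B
sumSubsets-distrib-+ zero    f g = refl
sumSubsets-distrib-+ (suc n) f g = begin
  ∑[ B ⊆ n ] (f (true ∷ B) + g (true ∷ B)) + ∑[ B ⊆ n ] (f (false ∷ B) + g (false ∷ B))
    ≡⟨ cong₂ _+_ (sumSubsets-distrib-+ n _ _) (sumSubsets-distrib-+ n _ _) ⟩
  (∑[ B ⊆ n ] f (true ∷ B) + ∑[ B ⊆ n ] g (true ∷ B))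
    + (∑[ B ⊆ n ] f (false ∷ B) + ∑[ B ⊆ n ] g (false ∷ B))
    ≡⟨ interchange (∑[ B ⊆ n ] f (true ∷ B)) _ _ _ ⟩
  ∑[ B ⊆ suc n ] f B + ∑[ B ⊆ suc n ] g B ∎
  where open ≡-Reasoning

*-distribˡ-sumSubsets : ∀ n c (f : Subset n → ℕ) → c * ∑[ B ⊆ n ] f B ≡ ∑[ B ⊆ n ] (c * f B)
*-distribˡ-sumSubsets zero    c f = refl
*-distribˡ-sumSubsets (suc n) c f =
  trans (*-distribˡ-+ c _ _) (cong₂ _+_ (*-distribˡ-sumSubsets n c _) (*-distribˡ-sumSubsets n c _))

sumSubsets-const : ∀ n c → ∑[ B ⊆ n ] c ≡ c * 2 ^ n
sumSubsets-const zero    c = sym (*-identityʳ c)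
sumSubsets-const (suc n) c = begin
  ∑[ B ⊆ n ] c + ∑[ B ⊆ n ] c ≡⟨ cong₂ _+_ (sumSubsets-const n c) (sumSubsets-const n c) ⟩
  c * 2 ^ n + c * 2 ^ n       ≡⟨ *-distribˡ-+ c (2 ^ n) _ ⟨
  c * (2 ^ n + 2 ^ n)         ≡⟨ cong (λ p → c * (2 ^ n + p)) (+-identityʳ (2 ^ n)) ⟨
  c * 2 ^ suc n               ∎
  where open ≡-Reasoning

sumSubsets-comm-∑ : ∀ n k (f : Fin k → Subset n → ℕ) →
  ∑[ i < k ] ∑[ B ⊆ n ] f i B ≡ ∑[ B ⊆ n ] ∑[ i < k ] f i B
sumSubsets-comm-∑ n zero    f = sym (sumSubsets-const n 0)
sumSubsets-comm-∑ n (suc k) f = trans (cong (∑[ B ⊆ n ] f zero B +_) (sumSubsets-comm-∑ n k (f ∘ suc)))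
                                      (sym (sumSubsets-distrib-+ n (f zero) _))

sumSubsets-allSubsets : ∀ n (f : Subset n → ℕ) → List.sum (map f (allSubsets n)) ≡ ∑[ B ⊆ n ] f B
sumSubsets-allSubsets zero    f = +-identityʳ (f [])
sumSubsets-allSubsets (suc n) f = begin
  List.sum (map f (map (true ∷_) Bs ++ map (false ∷_) Bs))
    ≡⟨ cong List.sum (map-++ f (map (true ∷_) Bs) _) ⟩
  List.sum (map f (map (true ∷_) Bs) ++ map f (map (false ∷_) Bs))
    ≡⟨ sum-++ (map f (map (true ∷_) Bs)) _ ⟩
  List.sum (map f (map (true ∷_) Bs)) + List.sum (map f (map (false ∷_) Bs))
    ≡⟨ cong₂ (λ xs ys → List.sum xs + List.sum ys) (map-∘ Bs) (map-∘ Bs) ⟨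
  List.sum (map (f ∘ (true ∷_)) Bs) + List.sum (map (f ∘ (false ∷_)) Bs)
    ≡⟨ cong₂ _+_ (sumSubsets-allSubsets n _) (sumSubsets-allSubsets n _) ⟩
  ∑[ B ⊆ suc n ] f B ∎
  where
  open ≡-Reasoning
  Bs = allSubsets n

length-filterᵇ : ∀ {A : Set} (p : A → Bool) xs → length (filterᵇ p xs) ≡ List.sum (map (𝟙 ∘ p) xs)
length-filterᵇ p []       = refl
length-filterᵇ p (x ∷ xs) with p x
... | true  = cong suc (length-filterᵇ p xs)
... | false = length-filterᵇ p xs

card≡sumSubsets : ∀ {n} (𝒜 : Family n) → card 𝒜 ≡ ∑[ B ⊆ n ] 𝟙 (𝒜 B)
card≡sumSubsets {n} 𝒜 = trans (length-filterᵇ 𝒜 (allSubsets n)) (sumSubsets-allSubsets n (𝟙 ∘ 𝒜))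

sum-tabulate : ∀ {k} (f : Fin k → ℕ) → List.sum (tabulate f) ≡ sum f
sum-tabulate {zero}  f = refl
sum-tabulate {suc k} f = cong (f zero +_) (sum-tabulate (f ∘ suc))

totalSize≡∑card : ∀ {n k} (𝒜 : Fin k → Family n) → totalSize 𝒜 ≡ ∑[ i < k ] card (𝒜 i)
totalSize≡∑card 𝒜 = trans (cong List.sum (map-tabulate id (card ∘ 𝒜))) (sum-tabulate (card ∘ 𝒜))

totalSize≡sumSubsets : ∀ {n k} (𝒜 : Fin k → Family n) →
  totalSize 𝒜 ≡ ∑[ B ⊆ n ] ∑[ i < k ] 𝟙 (𝒜 i B)
totalSize≡sumSubsets {n} {k} 𝒜 = begin
  totalSize 𝒜                     ≡⟨ totalSize≡∑card 𝒜 ⟩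
  ∑[ i < k ] card (𝒜 i)           ≡⟨ sum-cong-≗ (card≡sumSubsets ∘ 𝒜) ⟩
  ∑[ i < k ] ∑[ B ⊆ n ] 𝟙 (𝒜 i B) ≡⟨ sumSubsets-comm-∑ n k (λ i B → 𝟙 (𝒜 i B)) ⟩
  ∑[ B ⊆ n ] ∑[ i < k ] 𝟙 (𝒜 i B) ∎
  where open ≡-Reasoning

sumUpTo : ℕ → (ℕ → ℕ) → ℕ
sumUpTo L f = List.sum (applyUpTo f L)

sumUpTo-cong : ∀ L {f g : ℕ → ℕ} → (∀ t → t < L → f t ≡ g t) → sumUpTo L f ≡ sumUpTo L g
sumUpTo-cong zero    f≗g = refl
sumUpTo-cong (suc L) f≗g = cong₂ _+_ (f≗g 0 z<s) (sumUpTo-cong L (λ t t<L → f≗g (suc t) (s<s t<L)))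

sumUpTo-mono-≤ : ∀ L {f g : ℕ → ℕ} → (∀ t → t < L → f t ≤ g t) → sumUpTo L f ≤ sumUpTo L g
sumUpTo-mono-≤ zero    f≤g = z≤n
sumUpTo-mono-≤ (suc L) f≤g = +-mono-≤ (f≤g 0 z<s) (sumUpTo-mono-≤ L (λ t t<L → f≤g (suc t) (s<s t<L)))

sumUpTo-+ : ∀ a b (f : ℕ → ℕ) → sumUpTo (a + b) f ≡ sumUpTo a f + sumUpTo b (λ t → f (a + t))
sumUpTo-+ zero    b f = refl
sumUpTo-+ (suc a) b f = trans (cong (f 0 +_) (sumUpTo-+ a b (f ∘ suc))) (sym (+-assoc (f 0) _ _))

sumUpTo-split₃ : ∀ {n} L k (f : ℕ → ℕ) → L + k ≡ n →
  sumUpTo (suc n) f ≡ f 0 + sumUpTo L (f ∘ suc) + sumUpTo k (λ t → f (suc (L + t)))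
sumUpTo-split₃ L k f refl = trans (cong (f 0 +_) (sumUpTo-+ L k (f ∘ suc))) (sym (+-assoc (f 0) _ _))

sumUpTo-zero : ∀ L → sumUpTo L (λ _ → 0) ≡ 0
sumUpTo-zero zero    = refl
sumUpTo-zero (suc L) = sumUpTo-zero L

sumUpTo-select : ∀ {x L} y → x < L → sumUpTo L (λ t → 𝟙 (x ≡ᵇ t) * y) ≡ y
sumUpTo-select {zero}  {suc L} y _ =
  trans (cong (1 * y +_) (sumUpTo-zero L)) (trans (+-identityʳ _) (*-identityˡ y))
sumUpTo-select {suc x} {suc L} y (s<s x<L) = sumUpTo-select y x<L

sumSubsets-comm-sumUpTo : ∀ n L (f : ℕ → Subset n → ℕ) →
  sumUpTo L (λ t → ∑[ B ⊆ n ] f t B) ≡ ∑[ B ⊆ n ] sumUpTo L (λ t → f t B)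
sumSubsets-comm-sumUpTo n zero    f = sym (sumSubsets-const n 0)
sumSubsets-comm-sumUpTo n (suc L) f =
  trans (cong (∑[ B ⊆ n ] f 0 B +_) (sumSubsets-comm-sumUpTo n L (f ∘ suc))) (sym (sumSubsets-distrib-+ n (f 0) _))

level : ∀ n → ℕ → (Subset n → ℕ) → ℕ
level n t f = ∑[ B ⊆ n ] (𝟙 (∣ B ∣ ≡ᵇ t) * f B)

level-count : ∀ n t → level n t (λ _ → 1) ≡ n C t
level-count zero    zero    = refl
level-count zero    (suc t) = refl
level-count (suc n) zero    = trans (cong (_+ level n 0 (λ _ → 1)) (sumSubsets-const n 0)) (level-count n 0)
level-count (suc n) (suc t) =
  trans (cong₂ _+_ (level-count n t) (level-count n (suc t))) (nCk+nC[k+1]≡[n+1]C[k+1] n t)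

sumSubsets-byLevel : ∀ n (f : Subset n → ℕ) → ∑[ B ⊆ n ] f B ≡ sumUpTo (suc n) (λ t → level n t f)
sumSubsets-byLevel n f = begin
  ∑[ B ⊆ n ] f B
    ≡⟨ sumSubsets-cong n (λ B → sumUpTo-select (f B) (s≤s (∣p∣≤n B))) ⟨
  ∑[ B ⊆ n ] sumUpTo (suc n) (λ t → 𝟙 (∣ B ∣ ≡ᵇ t) * f B)
    ≡⟨ sumSubsets-comm-sumUpTo n (suc n) (λ t B → 𝟙 (∣ B ∣ ≡ᵇ t) * f B) ⟨
  sumUpTo (suc n) (λ t → level n t f) ∎
  where open ≡-Reasoning

level-bySize : ∀ n t (g : ℕ → ℕ) → level n t (g ∘ ∣_∣) ≡ g t * (n C t)
level-bySize n t g = begin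
  ∑[ B ⊆ n ] (𝟙 (∣ B ∣ ≡ᵇ t) * g ∣ B ∣)   ≡⟨ sumSubsets-cong n (λ B → 𝟙≡ᵇ-subst g ∣ B ∣ t) ⟩
  ∑[ B ⊆ n ] (𝟙 (∣ B ∣ ≡ᵇ t) * g t)       ≡⟨ sumSubsets-cong n (λ B → pull-out (𝟙 (∣ B ∣ ≡ᵇ t))) ⟩
  ∑[ B ⊆ n ] (g t * (𝟙 (∣ B ∣ ≡ᵇ t) * 1)) ≡⟨ *-distribˡ-sumSubsets n (g t) _ ⟨
  g t * level n t (λ _ → 1)               ≡⟨ cong (g t *_) (level-count n t) ⟩
  g t * (n C t)                           ∎
  where
  open ≡-Reasoning
  pull-out : ∀ x → x * g t ≡ g t * (x * 1)
  pull-out x = trans (*-comm x (g t)) (cong (g t *_) (sym (*-identityʳ x)))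

sumSubsets-bySize : ∀ n (g : ℕ → ℕ) → ∑[ B ⊆ n ] g ∣ B ∣ ≡ sumUpTo (suc n) (λ t → g t * (n C t))
sumSubsets-bySize n g =
  trans (sumSubsets-byLevel n (g ∘ ∣_∣)) (sumUpTo-cong (suc n) (λ t _ → level-bySize n t g))

-- One-point extensions and double counting

∣insert∣ : ∀ {n} (X : Subset n) a → lookup X a ≡ false → ∣ X [ a ]≔ inside ∣ ≡ suc ∣ X ∣
∣insert∣ (false ∷ X) zero    _   = refl
∣insert∣ (true  ∷ X) (suc a) a∉X = cong suc (∣insert∣ X a a∉X)
∣insert∣ (false ∷ X) (suc a) a∉X = ∣insert∣ X a a∉X

∩-insert : ∀ {n} (X : Subset n) a → X ∩ (X [ a ]≔ inside) ≡ X
∩-insert (x ∷ X) zero    = cong₂ _∷_ (∧-identityʳ x) (∩-idem X)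
∩-insert (x ∷ X) (suc a) = cong₂ _∷_ (∧-idem x) (∩-insert X a)

insert-∩-insert : ∀ {n} (X : Subset n) {a b} → a ≢ b → (X [ a ]≔ inside) ∩ (X [ b ]≔ inside) ≡ X
insert-∩-insert (x ∷ X) {zero}  {zero}  a≢b = contradiction refl a≢b
insert-∩-insert (x ∷ X) {zero}  {suc b} a≢b = cong (x ∷_) (∩-insert X b)
insert-∩-insert (x ∷ X) {suc a} {zero}  a≢b = cong₂ _∷_ (∧-identityʳ x) (trans (∩-comm _ X) (∩-insert X a))
insert-∩-insert (x ∷ X) {suc a} {suc b} a≢b = cong₂ _∷_ (∧-idem x) (insert-∩-insert X (a≢b ∘ cong suc))

insert-petal : ∀ {n} (X : Subset n) a → lookup X a ≡ false → a ∈ (X [ a ]≔ inside) ─ X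
insert-petal (false ∷ X) zero    _   = here
insert-petal (x     ∷ X) (suc a) a∉X = there (insert-petal X a a∉X)

complementSize : ∀ {n} → Subset n → ℕ
complementSize {n} X = ∑[ a < n ] 𝟙 (not (lookup X a))

complementSize+∣∣ : ∀ {n} (X : Subset n) → complementSize X + ∣ X ∣ ≡ n
complementSize+∣∣ []          = refl
complementSize+∣∣ (true  ∷ X) = trans (+-suc (complementSize X) ∣ X ∣) (cong suc (complementSize+∣∣ X))
complementSize+∣∣ (false ∷ X) = cong suc (complementSize+∣∣ X)

sumAbove : ∀ {n} → Subset n → (Subset n → ℕ) → ℕ
sumAbove {n} X h = ∑[ a < n ] (𝟙 (not (lookup X a)) * h (X [ a ]≔ inside))

sumAbove-one : ∀ {n} (X : Subset n) → sumAbove X (λ _ → 1) ≡ complementSize X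
sumAbove-one X = sum-cong-≗ (λ a → *-identityʳ (𝟙 (not (lookup X a))))

sumSubsets-sumAbove : ∀ n (h : Subset n → ℕ) → ∑[ X ⊆ n ] sumAbove X h ≡ ∑[ B ⊆ n ] (∣ B ∣ * h B)
sumSubsets-sumAbove zero    h = refl
sumSubsets-sumAbove (suc n) h = begin
  ∑[ X ⊆ n ] sumAbove X hᵀ + ∑[ X ⊆ n ] (1 * hᵀ X + sumAbove X hᶠ)
    ≡⟨ cong (∑[ X ⊆ n ] sumAbove X hᵀ +_) (sumSubsets-distrib-+ n (λ X → 1 * hᵀ X) (λ X → sumAbove X hᶠ)) ⟩
  ∑[ X ⊆ n ] sumAbove X hᵀ + (∑[ X ⊆ n ] (1 * hᵀ X) + ∑[ X ⊆ n ] sumAbove X hᶠ)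
    ≡⟨ cong₂ (λ x y → x + (y + ∑[ X ⊆ n ] sumAbove X hᶠ))
             (sumSubsets-sumAbove n hᵀ) (sumSubsets-cong n (*-identityˡ ∘ hᵀ)) ⟩
  ∑[ B ⊆ n ] (∣ B ∣ * hᵀ B) + (∑[ B ⊆ n ] hᵀ B + ∑[ X ⊆ n ] sumAbove X hᶠ)
    ≡⟨ +-assoc (∑[ B ⊆ n ] (∣ B ∣ * hᵀ B)) _ _ ⟨
  ∑[ B ⊆ n ] (∣ B ∣ * hᵀ B) + ∑[ B ⊆ n ] hᵀ B + ∑[ X ⊆ n ] sumAbove X hᶠ
    ≡⟨ cong₂ _+_ (trans (+-comm (∑[ B ⊆ n ] (∣ B ∣ * hᵀ B)) _) (sym (sumSubsets-distrib-+ n hᵀ _)))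
                 (sumSubsets-sumAbove n hᶠ) ⟩
  ∑[ B ⊆ n ] (hᵀ B + ∣ B ∣ * hᵀ B) + ∑[ B ⊆ n ] (∣ B ∣ * hᶠ B) ∎
  where
  open ≡-Reasoning
  hᵀ hᶠ : Subset n → ℕ
  hᵀ = h ∘ (true ∷_)
  hᶠ = h ∘ (false ∷_)

sumAbove-level : ∀ {n} u (h : Subset n → ℕ) X →
  sumAbove X (λ B → 𝟙 (∣ B ∣ ≡ᵇ suc u) * h B) ≡ 𝟙 (∣ X ∣ ≡ᵇ u) * sumAbove X h
sumAbove-level {n} u h X =
  trans (sum-cong-≗ term) (sym (*-distribˡ-sum (𝟙 (∣ X ∣ ≡ᵇ u)) (λ a → 𝟙 (not (lookup X a)) * h (X [ a ]≔ inside))))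
  where
  term : ∀ a → 𝟙 (not (lookup X a)) * (𝟙 (∣ X [ a ]≔ inside ∣ ≡ᵇ suc u) * h (X [ a ]≔ inside))
             ≡ 𝟙 (∣ X ∣ ≡ᵇ u) * (𝟙 (not (lookup X a)) * h (X [ a ]≔ inside))
  term a with lookup X a in a∉X
  ... | true  = sym (*-zeroʳ (𝟙 (∣ X ∣ ≡ᵇ u)))
  ... | false rewrite ∣insert∣ X a a∉X =
    trans (*-identityˡ _) (cong (𝟙 (∣ X ∣ ≡ᵇ u) *_) (sym (*-identityˡ _)))

level-double-count : ∀ n u (h : Subset n → ℕ) →
  suc u * level n (suc u) h ≡ ∑[ X ⊆ n ] (𝟙 (∣ X ∣ ≡ᵇ u) * sumAbove X h)
level-double-count n u h = begin
  suc u * level n (suc u) h                               ≡⟨ *-distribˡ-sumSubsets n (suc u) _ ⟩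
  ∑[ B ⊆ n ] (suc u * (𝟙 (∣ B ∣ ≡ᵇ suc u) * h B))        ≡⟨ sumSubsets-cong n size-weight ⟩
  ∑[ B ⊆ n ] (∣ B ∣ * (𝟙 (∣ B ∣ ≡ᵇ suc u) * h B))        ≡⟨ sumSubsets-sumAbove n _ ⟨
  ∑[ X ⊆ n ] sumAbove X (λ B → 𝟙 (∣ B ∣ ≡ᵇ suc u) * h B) ≡⟨ sumSubsets-cong n (sumAbove-level u h) ⟩
  ∑[ X ⊆ n ] (𝟙 (∣ X ∣ ≡ᵇ u) * sumAbove X h)             ∎
  where
  open ≡-Reasoning
  size-weight : ∀ B → suc u * (𝟙 (∣ B ∣ ≡ᵇ suc u) * h B) ≡ ∣ B ∣ * (𝟙 (∣ B ∣ ≡ᵇ suc u) * h B)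
  size-weight B = begin
    suc u * (𝟙 (∣ B ∣ ≡ᵇ suc u) * h B)  ≡⟨ x∙yz≈y∙xz (suc u) (𝟙 (∣ B ∣ ≡ᵇ suc u)) (h B) ⟩
    𝟙 (∣ B ∣ ≡ᵇ suc u) * (suc u * h B)  ≡⟨ 𝟙≡ᵇ-subst (_* h B) ∣ B ∣ (suc u) ⟨
    𝟙 (∣ B ∣ ≡ᵇ suc u) * (∣ B ∣ * h B)  ≡⟨ x∙yz≈y∙xz (𝟙 (∣ B ∣ ≡ᵇ suc u)) ∣ B ∣ (h B) ⟩
    ∣ B ∣ * (𝟙 (∣ B ∣ ≡ᵇ suc u) * h B)  ∎

-- A greedy matching lemma for 0/1 matrices

colZeros : ∀ {k n} → (Fin k → Fin n → Bool) → Fin n → ℕ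
colZeros {k} M a = ∑[ i < k ] 𝟙 (not (M i a))

size : ∀ {n} → (Fin n → Bool) → ℕ
size {n} K = ∑[ a < n ] 𝟙 (K a)

zeros : ∀ {k n} → (Fin k → Fin n → Bool) → (Fin n → Bool) → ℕ
zeros {n = n} M K = ∑[ a < n ] (𝟙 (K a) * colZeros M a)

record Matching {k n} (M : Fin k → Fin n → Bool) (K : Fin n → Bool) : Set where
  field
    match      : Fin k → Fin n
    injective  : Injective _≡_ _≡_ match
    available  : ∀ i → K (match i) ≡ true
    compatible : ∀ i → M i (match i) ≡ true

module _ {k n} (M : Fin (suc k) → Fin n → Bool) (K : Fin n → Bool) where

  firstRowZeros : ℕ
  firstRowZeros = ∑[ a < n ] (𝟙 (K a) * 𝟙 (not (M zero a)))

  zeros-firstRow : zeros M K ≡ firstRowZeros + zeros (M ∘ suc) K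
  zeros-firstRow =
    trans (sum-cong-≗ (λ a → *-distribˡ-+ (𝟙 (K a)) (𝟙 (not (M zero a))) (colZeros (M ∘ suc) a)))
          (∑-distrib-+ (λ a → 𝟙 (K a) * 𝟙 (not (M zero a))) (λ a → 𝟙 (K a) * colZeros (M ∘ suc) a))

  firstRow≤zeros : firstRowZeros ≤ zeros M K
  firstRow≤zeros = subst (firstRowZeros ≤_) (sym zeros-firstRow) (m≤m+n _ _)

  firstRow-compatible : firstRowZeros ≡ 0 → ∀ {a} → K a ≡ true → M zero a ≡ true
  firstRow-compatible none {a} Kₐ = 𝟙-not≡0 (n≤0⇒n≡0 (m+n≤o⇒m≤o _ term≤0))
    where
    term≤0 : 𝟙 true * 𝟙 (not (M zero a)) ≤ 0
    term≤0 = subst (λ b → 𝟙 b * _ ≤ 0) Kₐ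
               (≤-trans (term≤sum (λ a → 𝟙 (K a) * 𝟙 (not (M zero a))) a) (≤-reflexive none))

  -- Row 0 gets a column it accepts, chosen so that deleting both removes a zero unless none is left.
  chooseColumn : 0 < size K → zeros M K < size K →
    ∃ λ c → K c ≡ true × M zero c ≡ true × (zeros M K ≡ 0 ⊎ 0 < firstRowZeros + colZeros (M ∘ suc) c)
  chooseColumn 0<size zeros<size with firstRowZeros in first≡ | zeros (M ∘ suc) K in rest≡
  ... | suc _ | _
    with a , term<Kₐ ← ∑<∑⇒∃< (λ a → 𝟙 (K a) * 𝟙 (not (M zero a))) (𝟙 ∘ K) (≤-<-trans firstRow≤zeros zeros<size)
    with Kₐ , Mₐ ← 𝟙*-<-𝟙 (K a) _ term<Kₐ =
    a , Kₐ , 𝟙-not≡0 Mₐ , inj₂ z<s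
  ... | zero | zero
    with a , 0<Kₐ ← 0<∑⇒∃0< (𝟙 ∘ K) 0<size
    with Kₐ ← 𝟙-pos 0<Kₐ =
    a , Kₐ , firstRow-compatible first≡ Kₐ , inj₁ (trans zeros-firstRow (cong₂ _+_ first≡ rest≡))
  ... | zero | suc _
    with a , 0<term ← 0<∑⇒∃0< (λ a → 𝟙 (K a) * colZeros (M ∘ suc) a) (subst (0 <_) (sym rest≡) z<s)
    with Kₐ , 0<colZeros ← 0<𝟙* (K a) _ 0<term =
    a , Kₐ , firstRow-compatible first≡ Kₐ , inj₂ 0<colZeros

size-punchIn : ∀ {n} (K : Fin (suc n) → Bool) c → K c ≡ true → size K ≡ suc (size (K ∘ punchIn c))
size-punchIn K c K_c = trans (sum-remove {i = c} (𝟙 ∘ K)) (cong (λ b → 𝟙 b + size (K ∘ punchIn c)) K_c)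

zeros-punchIn : ∀ {k n} (M : Fin k → Fin (suc n) → Bool) K c → K c ≡ true →
  zeros M K ≡ colZeros M c + zeros (λ i → M i ∘ punchIn c) (K ∘ punchIn c)
zeros-punchIn M K c K_c = trans (sum-remove {i = c} (λ a → 𝟙 (K a) * colZeros M a))
  (cong (_+ zeros (λ i → M i ∘ punchIn c) (K ∘ punchIn c))
        (trans (cong (λ b → 𝟙 b * colZeros M c) K_c) (*-identityˡ (colZeros M c))))

extend : ∀ {k n} {M : Fin (suc k) → Fin (suc n) → Bool} {K : Fin (suc n) → Bool} c →
  K c ≡ true → M zero c ≡ true → Matching (λ i → M (suc i) ∘ punchIn c) (K ∘ punchIn c) → Matching M K
extend {k} {n} {M} {K} c K_c M₀c m = record
  { match = match′ ; injective = injective′ ; available = available′ ; compatible = compatible′ }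
  where
  open Matching m
  match′ : Fin (suc k) → Fin (suc n)
  match′ zero    = c
  match′ (suc i) = punchIn c (match i)
  injective′ : Injective _≡_ _≡_ match′
  injective′ {zero}  {zero}  _  = refl
  injective′ {zero}  {suc j} eq = contradiction (sym eq) (Fin.punchInᵢ≢i c (match j))
  injective′ {suc i} {zero}  eq = contradiction eq (Fin.punchInᵢ≢i c (match i))
  injective′ {suc i} {suc j} eq = cong suc (injective (Fin.punchIn-injective c (match i) (match j) eq))
  available′ : ∀ i → K (match′ i) ≡ true
  available′ zero    = K_c
  available′ (suc i) = available i
  compatible′ : ∀ i → M i (match′ i) ≡ true
  compatible′ zero    = M₀c
  compatible′ (suc i) = compatible i

drop≤pred : ∀ {d u s} → d + u ≤ s → d + u ≡ 0 ⊎ 0 < d → u ≤ pred s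
drop≤pred {d}     _  (inj₁ d+u≡0) = subst (_≤ _) (sym (m+n≡0⇒n≡0 d d+u≡0)) z≤n
drop≤pred {suc d} {u} le (inj₂ _) = suc[m]≤n⇒m≤pred[n] (≤-trans (s≤s (m≤n+m u d)) le)

≤pred⇒< : ∀ {m n} → 0 < n → m ≤ pred n → m < n
≤pred⇒< (s≤s _) m≤pred = s≤s m≤pred

-- pred rather than <, so that the hypothesis survives down to no rows and no columns.
matching : ∀ {k n} (M : Fin k → Fin n → Bool) (K : Fin n → Bool) →
  k ≤ size K → zeros M K ≤ pred (size K) → Matching M K
matching {zero} M K _ _ =
  record { match = λ () ; injective = λ { {()} } ; available = λ () ; compatible = λ () }
matching {suc k} {zero} M K () _
matching {suc k} {suc n} M K k<size zeros≤ with 0<size ← <-≤-trans z<s k<size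
  with c , K_c , M₀c , progress ← chooseColumn M K 0<size (≤pred⇒< 0<size zeros≤) =
  extend c K_c M₀c (matching M′ (K ∘ punchIn c) (s≤s⁻¹ (subst (suc k ≤_) size≡ k<size))
                            (drop≤pred (subst₂ _≤_ zeros≡ (cong pred size≡) zeros≤)
                                       (map₁ (trans (sym zeros≡)) progress)))
  where
  M′ : Fin k → Fin n → Bool
  M′ i = M (suc i) ∘ punchIn c
  size≡ : size K ≡ suc (size (K ∘ punchIn c))
  size≡ = size-punchIn K c K_c
  zeros≡ : zeros M K ≡ (firstRowZeros M K + colZeros (M ∘ suc) c) + zeros M′ (K ∘ punchIn c)
  zeros≡ = trans (zeros-firstRow M K)
    (trans (cong (firstRowZeros M K +_) (zeros-punchIn (M ∘ suc) K c K_c))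
           (sym (+-assoc (firstRowZeros M K) (colZeros (M ∘ suc) c) _)))

-- The upper bound

module _ {n k} (𝒜 : Fin k → Family n) where

  missing : Subset n → ℕ
  missing B = ∑[ i < k ] 𝟙 (not (𝒜 i B))

  complementSize≤sumAbove-missing : SunflowerFree 𝒜 → ∀ X →
    k ≤ complementSize X → complementSize X ≤ sumAbove X missing
  complementSize≤sumAbove-missing sunflowerFree X k≤∣∁X∣ with complementSize X ≤? sumAbove X missing
  ... | yes ∣∁X∣≤ = ∣∁X∣≤
  ... | no  ∣∁X∣≰ = contradiction (A , X , compatible , A∩A≡X , petal) sunflowerFree
    where
    open Matching (matching (λ i a → 𝒜 i (X [ a ]≔ inside)) (λ a → not (lookup X a))
                            k≤∣∁X∣ (<⇒≤pred (≰⇒> ∣∁X∣≰)))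
    A : Fin k → Subset n
    A i = X [ match i ]≔ inside
    A∩A≡X : ∀ i j → i ≢ j → A i ∩ A j ≡ X
    A∩A≡X i j i≢j = insert-∩-insert X (i≢j ∘ injective)
    petal : ∀ i → Nonempty (A i ─ X)
    petal i = match i , insert-petal X (match i) (not-injective (available i))

  level-bound : SunflowerFree 𝒜 → ∀ u → u + k ≤ n → n C suc u ≤ level n (suc u) missing
  level-bound sunflowerFree u u+k≤n = *-cancelˡ-≤ (suc u) (begin
    suc u * (n C suc u)                                  ≡⟨ cong (suc u *_) (level-count n (suc u)) ⟨
    suc u * level n (suc u) (λ _ → 1)                    ≡⟨ level-double-count n u (λ _ → 1) ⟩
    ∑[ X ⊆ n ] (𝟙 (∣ X ∣ ≡ᵇ u) * sumAbove X (λ _ → 1))  ≤⟨ sumSubsets-mono-≤ n bound ⟩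
    ∑[ X ⊆ n ] (𝟙 (∣ X ∣ ≡ᵇ u) * sumAbove X missing)     ≡⟨ level-double-count n u missing ⟨
    suc u * level n (suc u) missing                      ∎)
    where
    open ≤-Reasoning
    bound : ∀ X → 𝟙 (∣ X ∣ ≡ᵇ u) * sumAbove X (λ _ → 1) ≤ 𝟙 (∣ X ∣ ≡ᵇ u) * sumAbove X missing
    bound X with ∣ X ∣ ≡ᵇ u in ∣X∣≡ᵇu
    ... | false = z≤n
    ... | true  = *-monoʳ-≤ 1 (≤-trans (≤-reflexive (sumAbove-one X))
                                        (complementSize≤sumAbove-missing sunflowerFree X k≤∣∁X∣))
      where
      k≤∣∁X∣ : k ≤ complementSize X
      k≤∣∁X∣ = +-cancelˡ-≤ u k (complementSize X) (begin
        u + k                      ≤⟨ u+k≤n ⟩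
        n                          ≡⟨ complementSize+∣∣ X ⟨
        complementSize X + ∣ X ∣   ≡⟨ cong (complementSize X +_) (≡ᵇ⇒≡ ∣ X ∣ u (subst T (sym ∣X∣≡ᵇu) _)) ⟩
        complementSize X + u       ≡⟨ +-comm (complementSize X) u ⟩
        u + complementSize X       ∎)

  present+missing : ∀ B → ∑[ i < k ] 𝟙 (𝒜 i B) + missing B ≡ k
  present+missing B = begin
    ∑[ i < k ] 𝟙 (𝒜 i B) + missing B          ≡⟨ ∑-distrib-+ (λ i → 𝟙 (𝒜 i B)) (λ i → 𝟙 (not (𝒜 i B))) ⟨
    ∑[ i < k ] (𝟙 (𝒜 i B) + 𝟙 (not (𝒜 i B))) ≡⟨ sum-cong-≗ (λ i → 𝟙-+-𝟙-not (𝒜 i B)) ⟩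
    ∑[ i < k ] 1                               ≡⟨ sum-const k 1 ⟩
    k * 1                                      ≡⟨ *-identityʳ k ⟩
    k                                          ∎
    where open ≡-Reasoning

  totalSize+missing : totalSize 𝒜 + ∑[ B ⊆ n ] missing B ≡ k * 2 ^ n
  totalSize+missing = begin
    totalSize 𝒜 + ∑[ B ⊆ n ] missing B
      ≡⟨ cong (_+ ∑[ B ⊆ n ] missing B) (totalSize≡sumSubsets 𝒜) ⟩
    ∑[ B ⊆ n ] ∑[ i < k ] 𝟙 (𝒜 i B) + ∑[ B ⊆ n ] missing B
      ≡⟨ sumSubsets-distrib-+ n _ missing ⟨
    ∑[ B ⊆ n ] (∑[ i < k ] 𝟙 (𝒜 i B) + missing B)
      ≡⟨ sumSubsets-cong n present+missing ⟩
    ∑[ B ⊆ n ] k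
      ≡⟨ sumSubsets-const n k ⟩
    k * 2 ^ n ∎
    where open ≡-Reasoning

middleLevels : ℕ → ℕ → ℕ
middleLevels n L = sumUpTo L (λ t → n C suc t)

topLevels : ℕ → ℕ → ℕ → ℕ
topLevels n L k = sumUpTo k (λ t → n C suc (L + t))

binomial-split : ∀ {n} L k → L + k ≡ n → 2 ^ n ≡ 1 + middleLevels n L + topLevels n L k
binomial-split {n} L k L+k≡n = begin
  2 ^ n                                  ≡⟨ *-identityˡ (2 ^ n) ⟨
  1 * 2 ^ n                              ≡⟨ sumSubsets-const n 1 ⟨
  ∑[ B ⊆ n ] 1                           ≡⟨ sumSubsets-bySize n (λ _ → 1) ⟩
  sumUpTo (suc n) (λ t → 1 * (n C t))    ≡⟨ sumUpTo-split₃ L k (λ t → 1 * (n C t)) L+k≡n ⟩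
  1 * (n C 0) + sumUpTo L (λ t → 1 * (n C suc t)) + sumUpTo k (λ t → 1 * (n C suc (L + t)))
    ≡⟨ cong₂ _+_ (cong₂ _+_ (*-identityˡ (n C 0)) (sumUpTo-cong L (λ t _ → *-identityˡ _)))
                 (sumUpTo-cong k (λ t _ → *-identityˡ _)) ⟩
  1 + middleLevels n L + topLevels n L k ∎
  where open ≡-Reasoning

module _ {n k} (𝒜 : Fin (suc k) → Family n) {L} (L+k≡n : L + k ≡ n) (sunflowerFree : SunflowerFree 𝒜) where

  middleLevels≤missing : middleLevels n L ≤ ∑[ B ⊆ n ] missing 𝒜 B
  middleLevels≤missing = begin
    middleLevels n L
      ≤⟨ sumUpTo-mono-≤ L (λ t t<L → level-bound 𝒜 sunflowerFree t (middle t<L)) ⟩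
    sumUpTo L (λ t → level n (suc t) (missing 𝒜))
      ≤⟨ m≤n+m _ _ ⟩
    level n 0 (missing 𝒜) + sumUpTo L (λ t → level n (suc t) (missing 𝒜))
      ≤⟨ m≤m+n _ _ ⟩
    level n 0 (missing 𝒜) + sumUpTo L (λ t → level n (suc t) (missing 𝒜))
      + sumUpTo k (λ t → level n (suc (L + t)) (missing 𝒜))
      ≡⟨ sumUpTo-split₃ L k (λ t → level n t (missing 𝒜)) L+k≡n ⟨
    sumUpTo (suc n) (λ t → level n t (missing 𝒜))
      ≡⟨ sumSubsets-byLevel n (missing 𝒜) ⟨
    ∑[ B ⊆ n ] missing 𝒜 B ∎
    where
    open ≤-Reasoning
    middle : ∀ {t} → t < L → t + suc k ≤ n
    middle {t} t<L = subst₂ _≤_ (sym (+-suc t k)) L+k≡n (+-monoˡ-≤ k t<L)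

  upper-bound : totalSize 𝒜 ≤ k * 2 ^ n + 1 + topLevels n L k
  upper-bound = +-cancelʳ-≤ (middleLevels n L) _ _ (begin
    totalSize 𝒜 + middleLevels n L                   ≤⟨ +-monoʳ-≤ (totalSize 𝒜) middleLevels≤missing ⟩
    totalSize 𝒜 + ∑[ B ⊆ n ] missing 𝒜 B             ≡⟨ totalSize+missing 𝒜 ⟩
    suc k * 2 ^ n                                    ≡⟨ cong (suc k *_) (binomial-split L k L+k≡n) ⟩
    suc k * (1 + middleLevels n L + topLevels n L k) ≡⟨ regroup k (middleLevels n L) (topLevels n L k) ⟩
    k * (1 + middleLevels n L + topLevels n L k) + 1 + topLevels n L k + middleLevels n L
      ≡⟨ cong (λ p → k * p + 1 + topLevels n L k + middleLevels n L) (binomial-split L k L+k≡n) ⟨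
    k * 2 ^ n + 1 + topLevels n L k + middleLevels n L ∎)
    where
    open ≤-Reasoning
    regroup : ∀ k m t → suc k * (1 + m + t) ≡ k * (1 + m + t) + 1 + t + m
    regroup = solve-∀

-- The extremal families

x∈p─q⇒x∉q : ∀ {n} {x : Fin n} (p q : Subset n) → x ∈ p ─ q → x ∉ q
x∈p─q⇒x∉q (_ ∷ p) (false ∷ q) here        ()
x∈p─q⇒x∉q (_ ∷ p) (_ ∷ q)     (there x∈) (there x∈q) = x∈p─q⇒x∉q p q x∈ x∈q

injection⇒≤∣∣ : ∀ {m n} (P : Subset n) (y : Fin m → Fin n) →
  Injective _≡_ _≡_ y → (∀ j → y j ∈ P) → m ≤ ∣ P ∣
injection⇒≤∣∣ {zero}  P y _ _ = z≤n
injection⇒≤∣∣ {suc m} P y injective y∈P = <-≤-trans (s≤s m≤∣P-y₀∣) (x∈p⇒∣p-x∣<∣p∣ (y∈P zero))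
  where
  m≤∣P-y₀∣ : m ≤ ∣ P - y zero ∣
  m≤∣P-y₀∣ = injection⇒≤∣∣ (P - y zero) (y ∘ suc) (Fin.suc-injective ∘ injective)
               (λ j → x∈p∧x≢y⇒x∈p-y (y∈P (suc j)) ((λ ()) ∘ injective))

∉-other-petals : ∀ {n k} {A : Fin k → Subset n} {core} → (∀ i j → i ≢ j → A i ∩ A j ≡ core) →
  ∀ {i j x} → i ≢ j → x ∈ A i ─ core → x ∉ A j
∉-other-petals {A = A} {core} A∩A≡core {i} {j} i≢j x∈Aᵢ─core x∈Aⱼ = x∈p─q⇒x∉q (A i) core x∈Aᵢ─core
  (subst (_ ∈_) (A∩A≡core i j i≢j) (x∈p∩q⁺ (p─q⊆p (A i) core x∈Aᵢ─core , x∈Aⱼ)))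

extremalSize : ℕ → ℕ → Bool
extremalSize L zero    = true
extremalSize L (suc t) = does (L <? suc t)

extremalSize-sound : ∀ L t → extremalSize L t ≡ true → t ≡ 0 ⊎ L < t
extremalSize-sound L zero    _  = inj₁ refl
extremalSize-sound L (suc t) ok = inj₂ (decidable-stable (L <? suc t) λ L≮ →
  contradiction (trans (sym (dec-false (L <? suc t) L≮)) ok) λ ())

extremal : ∀ {n k} → ℕ → Fin (suc k) → Family n
extremal L zero    B = extremalSize L ∣ B ∣
extremal L (suc _) _ = true

extremal-sunflowerFree : ∀ {n k} L → n ≤ L + k → SunflowerFree (extremal {n} {k} L)
extremal-sunflowerFree {n} {k} L n≤L+k (A , core , A∈ , A∩A≡core , petal)
  with extremalSize-sound L ∣ A zero ∣ (A∈ zero)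
... | inj₁ ∣A₀∣≡0 =
  <-irrefl (sym ∣A₀∣≡0) (≤-<-trans z≤n (x∈p⇒∣p-x∣<∣p∣ (p─q⊆p (A zero) core (proj₂ (petal zero)))))
... | inj₂ L<∣A₀∣ = <-irrefl refl (begin-strict
    L + k                       <⟨ +-monoˡ-< k L<∣A₀∣ ⟩
    ∣ A zero ∣ + k              ≡⟨ +-comm ∣ A zero ∣ k ⟩
    k + ∣ A zero ∣              ≤⟨ +-monoˡ-≤ ∣ A zero ∣ k≤∣∁A₀∣ ⟩
    n ∸ ∣ A zero ∣ + ∣ A zero ∣ ≡⟨ m∸n+n≡m (∣p∣≤n (A zero)) ⟩
    n                           ≤⟨ n≤L+k ⟩
    L + k                       ∎)
  where
  open ≤-Reasoning
  y : Fin k → Fin n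
  y j = proj₁ (petal (suc j))
  y∈petal : ∀ j → y j ∈ A (suc j) ─ core
  y∈petal j = proj₂ (petal (suc j))
  y-injective : Injective _≡_ _≡_ y
  y-injective {j} {j′} yⱼ≡yⱼ′ = decidable-stable (j Fin.≟ j′) λ j≢j′ →
    ∉-other-petals A∩A≡core (j≢j′ ∘ Fin.suc-injective) (y∈petal j)
                   (subst (_∈ A (suc j′)) (sym yⱼ≡yⱼ′) (p─q⊆p (A (suc j′)) core (y∈petal j′)))
  k≤∣∁A₀∣ : k ≤ n ∸ ∣ A zero ∣
  k≤∣∁A₀∣ = subst (k ≤_) (∣∁p∣≡n∸∣p∣ (A zero)) (injection⇒≤∣∣ (∁ (A zero)) y y-injective
              (λ j → x∉p⇒x∈∁p (∉-other-petals A∩A≡core (λ ()) (y∈petal j))))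

extremal-card : ∀ {n k} L → L + k ≡ n → card (extremal {n} {k} L zero) ≡ 1 + topLevels n L k
extremal-card {n} {k} L L+k≡n = begin
  card (extremal {n} {k} L zero)
    ≡⟨ card≡sumSubsets (extremal {n} {k} L zero) ⟩
  ∑[ B ⊆ n ] 𝟙 (extremalSize L ∣ B ∣)
    ≡⟨ sumSubsets-bySize n (𝟙 ∘ extremalSize L) ⟩
  sumUpTo (suc n) (λ t → 𝟙 (extremalSize L t) * (n C t))
    ≡⟨ sumUpTo-split₃ L k (λ t → 𝟙 (extremalSize L t) * (n C t)) L+k≡n ⟩
  1 + sumUpTo L (λ t → 𝟙 (extremalSize L (suc t)) * (n C suc t))
    + sumUpTo k (λ t → 𝟙 (extremalSize L (suc (L + t))) * (n C suc (L + t)))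
    ≡⟨ cong₂ (λ m t → 1 + m + t) (trans (sumUpTo-cong L middle) (sumUpTo-zero L)) (sumUpTo-cong k top) ⟩
  1 + topLevels n L k ∎
  where
  open ≡-Reasoning
  middle : ∀ t → t < L → 𝟙 (extremalSize L (suc t)) * (n C suc t) ≡ 0
  middle t t<L = cong (λ b → 𝟙 b * (n C suc t)) (dec-false (L <? suc t) (<⇒≱ t<L ∘ s≤s⁻¹))
  top : ∀ t → t < k → 𝟙 (extremalSize L (suc (L + t))) * (n C suc (L + t)) ≡ n C suc (L + t)
  top t _ = trans (cong (λ b → 𝟙 b * (n C suc (L + t))) (dec-true (L <? suc (L + t)) (s≤s (m≤m+n L t))))
                  (*-identityˡ _)

card-full : ∀ n → card (λ (_ : Subset n) → true) ≡ 2 ^ n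
card-full n =
  trans (card≡sumSubsets (λ (_ : Subset n) → true)) (trans (sumSubsets-const n 1) (*-identityˡ (2 ^ n)))

extremal-totalSize : ∀ {n k} L → L + k ≡ n →
  totalSize (extremal {n} {k} L) ≡ k * 2 ^ n + 1 + topLevels n L k
extremal-totalSize {n} {k} L L+k≡n = begin
  totalSize (extremal {n} {k} L)
    ≡⟨ totalSize≡∑card (extremal {n} {k} L) ⟩
  card (extremal {n} {k} L zero) + ∑[ i < k ] card (λ (_ : Subset n) → true)
    ≡⟨ cong₂ _+_ (extremal-card L L+k≡n) (trans (sum-const k _) (cong (k *_) (card-full n))) ⟩
  1 + topLevels n L k + k * 2 ^ n
    ≡⟨ +-comm (1 + topLevels n L k) (k * 2 ^ n) ⟩
  k * 2 ^ n + (1 + topLevels n L k)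
    ≡⟨ +-assoc (k * 2 ^ n) 1 (topLevels n L k) ⟨
  k * 2 ^ n + 1 + topLevels n L k ∎
  where open ≡-Reasoning

theorem2 : (n k : ℕ) → 3 ≤ k → k ≤ n → IsMaxSunflowerFreeSize n k (claimedValue n k)
theorem2 n (suc k) (s≤s _) k<n =
    (λ 𝒜 sunflowerFree → subst (totalSize 𝒜 ≤_) value (upper-bound 𝒜 L+k≡n sunflowerFree))
  , extremal L
  , extremal-sunflowerFree L (≤-reflexive (sym L+k≡n))
  , trans (extremal-totalSize L L+k≡n) value
  where
  L : ℕ
  L = n ∸ k
  L+k≡n : L + k ≡ n
  L+k≡n = m∸n+n≡m (<⇒≤ k<n)
  value : k * 2 ^ n + 1 + topLevels n L k ≡ claimedValue n (suc k)
  value = cong (λ a → k * 2 ^ n + 1 + rangeSum a k (n C_)) (begin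
    suc L         ≡⟨ +-∸-assoc 1 (<⇒≤ k<n) ⟨
    suc n ∸ k     ≡⟨ cong (_∸ suc k) (+-comm 2 n) ⟩
    n + 2 ∸ suc k ∎)
    where open ≡-Reasoning
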